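{- Let $h,n,k\ge 2$ with $k\le n!$. Then $\{V\times\{id\}: V\in\mathrm{BGR}_h(k)\}\subseteq\mathrm{SPFAG}_h(n)$. If $k=n=2$, equality holds: $\{V\times\{id\}:V\in\mathrm{BGR}_h(2)\}=\mathrm{SPFAG}_h(2)$, and consequently $\{V\times\{id\}:V\in\mathrm{BGR}(2)\}=\mathrm{SPFAG}(2)$.
   Context: A $k$-valued Boolean function on $h$ variables is a map $F:\{0,1\}^h\to\{0,\dots,k-1\}$; $\mathcal B_h(k)$ is the set of them. $S_h$ acts on $\{0,1\}^h$ by $x^\varphi=(x_{\varphi^{ -1}(1)},\dots,x_{\varphi^{ -1}(h)})$. The invariance group of $F\in\mathcal B_h(k)$ is $S(F)=\{\varphi\in S_h: F(x^\varphi)=F(x)\ \forall x\}$. $\mathrm{BGR}_h(k)=\{S(F):F\in\mathcal B_h(k)\}$ and $\mathrm{BGR}(2)=\bigcup_{h\ge 2}\mathrm{BGR}_h(2)$. For social preference functions: $G=S_h\times S_n$, $\mathcal P=(S_n)^h$, with $G$ acting by $p^{(\varphi,\psi)}_i=\psi\,p_{\varphi^{ -1}(i)}$ (products are compositions); an SPF is a map $F:\mathcal P\to S_n$; its anonymity group is $G_1(F)=\{(\varphi,id)\in G:F(p^{(\varphi,id)})=F(p)\ \forall p\}$; $\mathrm{SPFAG}_h(n)=\{G_1(F)\}$ over all SPFs, and $\mathrm{SPFAG}(2)=\bigcup_{h\ge2}\mathrm{SPFAG}_h(2)$. -}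

module Defs where

open import Data.Nat using (ℕ)
import Data.Nat
import Data.Product
open import Data.Bool using (Bool)
open import Data.Fin using (Fin)
open import Data.Vec using (Vec; tabulate; lookup)
open import Data.Fin.Permutation using (Permutation′; _⟨$⟩ʳ_; _⟨$⟩ˡ_; _∘ₚ_; id; _≈_)
open import Data.Product using (Σ; _×_; ∃)
open import Relation.Binary.PropositionalEquality using (_≡_)
open import Function.Bundles using (_⇔_)
open import Level using (0ℓ)

Sym : ℕ → Set
Sym = Permutation′

Subset : Set → Set₁
Subset A = A → Set

_≐_ : {A : Set} → Subset A → Subset A → Set
U ≐ W = ∀ a → U a ⇔ W a

Cube : ℕ → Set
Cube h = Vec Bool h

BoolFun : ℕ → ℕ → Set
BoolFun h k = Cube h → Fin k

actCube : ∀ {h} → Cube h → Sym h → Cube h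
actCube x φ = tabulate (λ i → lookup x (φ ⟨$⟩ˡ i))

InvGroup : ∀ {h k} → BoolFun h k → Subset (Sym h)
InvGroup F φ = ∀ x → F (actCube x φ) ≡ F x

BGR : (h k : ℕ) → Subset (Sym h) → Set
BGR h k V = Σ (BoolFun h k) λ F → V ≐ InvGroup F

Profile : ℕ → ℕ → Set
Profile h n = Fin h → Sym n

-- p^(φ,ψ)_i = ψ p_{φ⁻¹(i)}   (ψ ∘ p_j, i.e. first p_j then ψ, is p_j ∘ₚ ψ)
actProfile : ∀ {h n} → Profile h n → Sym h × Sym n → Profile h n
actProfile p (φ Data.Product., ψ) i = p (φ ⟨$⟩ˡ i) ∘ₚ ψ

_≈P_ : ∀ {h n} → Profile h n → Profile h n → Set
p ≈P q = ∀ i → p i ≈ q i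

record SPF (h n : ℕ) : Set where
  field
    fun  : Profile h n → Sym n
    cong : ∀ {p q} → p ≈P q → fun p ≈ fun q
open SPF public

AnonGroup : ∀ {h n} → SPF h n → Subset (Sym h × Sym n)
AnonGroup F (φ Data.Product., ψ) =
  ψ ≈ id × (∀ p → fun F (actProfile p (φ Data.Product., ψ)) ≈ fun F p)

SPFAG : (h n : ℕ) → Subset (Sym h × Sym n) → Set
SPFAG h n W = Σ (SPF h n) λ F → W ≐ AnonGroup F

times-id : ∀ {h n} → Subset (Sym h) → Subset (Sym h × Sym n)
times-id V (φ Data.Product., ψ) = V φ × ψ ≈ id

BGRxId : (h k n : ℕ) → Subset (Sym h × Sym n) → Set₁
BGRxId h k n W = Σ (Subset (Sym h)) λ V → BGR h k V × (W ≐ times-id V)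

-- Unions over h ≥ 2 : families of pairs (h , W) with W ⊆ S_h × S_2

BGR2xId-union : (Σ ℕ λ h → Subset (Sym h × Sym 2)) → Set₁
BGR2xId-union (h Data.Product., W) = 2 Data.Nat.≤ h × BGRxId h 2 2 W

SPFAG2-union : (Σ ℕ λ h → Subset (Sym h × Sym 2)) → Set
SPFAG2-union (h Data.Product., W) = 2 Data.Nat.≤ h × SPFAG h 2 W

-- Read each voter's linear order on {0,…,n-1} as one bit: whether it ranks 0 first. A profile thus
-- yields a point of the cube, compatibly with permuting voters when the alternatives are left fixed,
-- and every point arises from the profile whose voters use only id and the transposition (0 1).
-- Composing a Boolean function F with this reading and with an injection of its k values into S_n
-- (possible as k ≤ n!) gives an SPF whose anonymity group is exactly S(F) × {id}. For n = 2 a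
-- permutation is its bit, so every SPF is, up to pointwise equality, of this form with k = 2.
module Submission where

open import Defs hiding (cong)
open import Data.Nat using (ℕ; _*_; _≤_; _!; zero; suc; s≤s; z≤n)
open import Data.Product using (_×_; _,_; proj₁; proj₂; uncurry)
open import Data.Bool using (Bool; true; false)
open import Data.Fin using (Fin; zero; suc; remQuot; combine; inject≤; punchIn)
open import Data.Fin.Properties using (combine-remQuot; inject≤-injective; punchIn-injective)
open import Data.Fin.Permutation
  using (_⟨$⟩ʳ_; _⟨$⟩ˡ_; id; _≈_; insert; insert-punchIn; transpose; inverseˡ)
open import Data.Vec using (tabulate; lookup)
open import Data.Vec.Properties using (tabulate-cong; lookup∘tabulate; tabulate∘lookup)
open import Relation.Binary.PropositionalEquality
  using (_≡_; _≢_; refl; sym; trans; cong; cong₂; module ≡-Reasoning)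
open import Function.Bundles using (mk⇔; Equivalence)

open Equivalence using (to; from)

≐-trans : {A : Set} {U V W : Subset A} → U ≐ V → V ≐ W → U ≐ W
≐-trans U≐V V≐W a = mk⇔ (λ u → to (V≐W a) (to (U≐V a) u)) (λ w → from (U≐V a) (from (V≐W a) w))

≐-sym : {A : Set} {U V : Subset A} → U ≐ V → V ≐ U
≐-sym U≐V a = mk⇔ (from (U≐V a)) (to (U≐V a))

times-id-cong : ∀ {h n} {V V′ : Subset (Sym h)} → V ≐ V′ → times-id {n = n} V ≐ times-id V′
times-id-cong V≐V′ (φ , ψ) =
  mk⇔ (λ (v , ψ≈id) → to (V≐V′ φ) v , ψ≈id) (λ (v , ψ≈id) → from (V≐V′ φ) v , ψ≈id)

anonGroup-cong : ∀ {h n} (G G′ : SPF h n) → (∀ p → fun G p ≈ fun G′ p) → AnonGroup G ≐ AnonGroup G′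
anonGroup-cong G G′ G≈G′ (φ , ψ) = mk⇔
  (λ (ψ≈id , inv) → ψ≈id , λ p i →
    trans (sym (G≈G′ (actProfile p (φ , ψ)) i)) (trans (inv p i) (G≈G′ p i)))
  (λ (ψ≈id , inv) → ψ≈id , λ p i →
    trans (G≈G′ (actProfile p (φ , ψ)) i) (trans (inv p i) (sym (G≈G′ p i))))

remQuot-injective : ∀ {m} n (c c′ : Fin (m * n)) → remQuot {m} n c ≡ remQuot n c′ → c ≡ c′
remQuot-injective {m} n c c′ eq = begin
  c                                  ≡⟨ sym (combine-remQuot {m} n c) ⟩
  uncurry combine (remQuot {m} n c)  ≡⟨ cong (uncurry combine) eq ⟩
  uncurry combine (remQuot {m} n c′) ≡⟨ combine-remQuot {m} n c′ ⟩
  c′                                 ∎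
  where open ≡-Reasoning

insert₀-injective : ∀ {n} (i i′ : Fin (suc n)) (π π′ : Sym n) →
                    insert zero i π ≈ insert zero i′ π′ → i ≡ i′ × π ≈ π′
insert₀-injective i i′ π π′ eq = i≡i′ , λ k → punchIn-injective i _ _ (begin
  punchIn i (π ⟨$⟩ʳ k)         ≡⟨ sym (insert-punchIn zero i π k) ⟩
  insert zero i π ⟨$⟩ʳ suc k    ≡⟨ eq (suc k) ⟩
  insert zero i′ π′ ⟨$⟩ʳ suc k  ≡⟨ insert-punchIn zero i′ π′ k ⟩
  punchIn i′ (π′ ⟨$⟩ʳ k)       ≡⟨ cong (λ j → punchIn j (π′ ⟨$⟩ʳ k)) (sym i≡i′) ⟩
  punchIn i (π′ ⟨$⟩ʳ k)        ∎)
  where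
  open ≡-Reasoning
  i≡i′ : i ≡ i′
  i≡i′ = eq zero

-- Lehmer code: the quotient of c by (n-1)! is the image of 0, the remainder codes the rest.
fromFactorial : ∀ n → Fin (n !) → Sym n
fromFactorial zero    _ = id
fromFactorial (suc n) c = insert zero i (fromFactorial n j)
  where
  i = proj₁ (remQuot {suc n} (n !) c)
  j = proj₂ (remQuot {suc n} (n !) c)

fromFactorial-injective : ∀ n (c c′ : Fin (n !)) → fromFactorial n c ≈ fromFactorial n c′ → c ≡ c′
fromFactorial-injective zero    zero zero _  = refl
fromFactorial-injective (suc n) c    c′   eq = remQuot-injective {suc n} (n !) c c′
  (cong₂ _,_ (proj₁ heads&tails) (fromFactorial-injective n _ _ (proj₂ heads&tails)))
  where heads&tails = insert₀-injective _ _ _ _ eq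

isZero : ∀ {n} → Fin n → Bool
isZero zero    = true
isZero (suc _) = false

module Ballots (m : ℕ) where
  N : ℕ
  N = suc (suc m)

  vote : Bool → Sym N
  vote true  = id
  vote false = transpose zero (suc zero)

  ballot : Sym N → Bool
  ballot σ = isZero (σ ⟨$⟩ʳ zero)

  ballot-vote : ∀ b → ballot (vote b) ≡ b
  ballot-vote true  = refl
  ballot-vote false = refl

  profileOf : ∀ {h} → Cube h → Profile h N
  profileOf x i = vote (lookup x i)

  readProfile : ∀ {h} → Profile h N → Cube h
  readProfile p = tabulate (λ i → ballot (p i))

  readProfile-profileOf : ∀ {h} (x : Cube h) → readProfile (profileOf x) ≡ x
  readProfile-profileOf x = trans (tabulate-cong (λ i → ballot-vote (lookup x i))) (tabulate∘lookup x)

  readProfile-cong : ∀ {h} (p q : Profile h N) → p ≈P q → readProfile p ≡ readProfile q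
  readProfile-cong _ _ p≈q = tabulate-cong (λ i → cong isZero (p≈q i zero))

  readProfile-act : ∀ {h} (p : Profile h N) (φ : Sym h) (ψ : Sym N) → ψ ≈ id →
                    readProfile (actProfile p (φ , ψ)) ≡ actCube (readProfile p) φ
  readProfile-act p φ _ ψ≈id = tabulate-cong (λ i →
    trans (cong isZero (ψ≈id (p (φ ⟨$⟩ˡ i) ⟨$⟩ʳ zero)))
          (sym (lookup∘tabulate (λ j → ballot (p j)) (φ ⟨$⟩ˡ i))))

  inducedSPF : ∀ {h k} → BoolFun h k → (Fin k → Sym N) → SPF h N
  inducedSPF F code = record
    { fun  = λ p → code (F (readProfile p))
    ; cong = λ {p} {q} p≈q i → cong (λ x → code (F x) ⟨$⟩ʳ i) (readProfile-cong p q p≈q)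
    }

  anonGroup-inducedSPF : ∀ {h k} (F : BoolFun h k) (code : Fin k → Sym N) →
                         (∀ a a′ → code a ≈ code a′ → a ≡ a′) →
                         AnonGroup (inducedSPF F code) ≐ times-id (InvGroup F)
  anonGroup-inducedSPF F code code-injective (φ , ψ) = mk⇔
    (λ (ψ≈id , inv) → invariant⇒ ψ≈id inv , ψ≈id)
    (λ (inv , ψ≈id) → ψ≈id , λ p i →
      cong (λ x → code x ⟨$⟩ʳ i) (trans (cong F (readProfile-act p φ ψ ψ≈id)) (inv (readProfile p))))
    where
    G = inducedSPF F code
    invariant⇒ : ψ ≈ id → (∀ p → fun G (actProfile p (φ , ψ)) ≈ fun G p) → InvGroup F φ
    invariant⇒ ψ≈id inv x = begin
      F (actCube x φ)                                    ≡⟨ cong (λ y → F (actCube y φ)) (sym (readProfile-profileOf x)) ⟩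
      F (actCube (readProfile (profileOf x)) φ)          ≡⟨ cong F (sym (readProfile-act (profileOf x) φ ψ ψ≈id)) ⟩
      F (readProfile (actProfile (profileOf x) (φ , ψ))) ≡⟨ code-injective _ _ (inv (profileOf x)) ⟩
      F (readProfile (profileOf x))                      ≡⟨ cong F (readProfile-profileOf x) ⟩
      F x                                                ∎
      where open ≡-Reasoning

bgrxId⊆spfag : ∀ h n k → 2 ≤ n → k ≤ n ! → ∀ W → BGRxId h k n W → SPFAG h n W
bgrxId⊆spfag h (suc (suc m)) k (s≤s (s≤s z≤n)) k≤n! W (V , (F , V≐S[F]) , W≐V×id) =
  inducedSPF F code ,
  ≐-trans W≐V×id (≐-trans (times-id-cong V≐S[F]) (≐-sym (anonGroup-inducedSPF F code code-injective)))
  where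
  open Ballots m
  code : Fin k → Sym N
  code a = fromFactorial N (inject≤ a k≤n!)
  code-injective : ∀ a a′ → code a ≈ code a′ → a ≡ a′
  code-injective a a′ eq = inject≤-injective k≤n! k≤n! a a′ (fromFactorial-injective N _ _ eq)

open Ballots 0

other-unique : (a x y : Fin 2) → a ≢ x → a ≢ y → x ≡ y
other-unique zero       zero       _          a≢x _   with () ← a≢x refl
other-unique zero       (suc zero) zero       _   a≢y with () ← a≢y refl
other-unique zero       (suc zero) (suc zero) _   _   = refl
other-unique (suc zero) (suc zero) _          a≢x _   with () ← a≢x refl
other-unique (suc zero) zero       (suc zero) _   a≢y with () ← a≢y refl
other-unique (suc zero) zero       zero       _   _   = refl

permute-zero≢permute-one : (σ : Sym 2) → σ ⟨$⟩ʳ zero ≢ σ ⟨$⟩ʳ suc zero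
permute-zero≢permute-one σ eq with () ← trans (sym (inverseˡ σ)) (trans (cong (σ ⟨$⟩ˡ_) eq) (inverseˡ σ))

sym₂-determined : (σ ρ : Sym 2) → σ ⟨$⟩ʳ zero ≡ ρ ⟨$⟩ʳ zero → σ ≈ ρ
sym₂-determined σ ρ eq zero       = eq
sym₂-determined σ ρ eq (suc zero) = other-unique (σ ⟨$⟩ʳ zero) _ _
  (permute-zero≢permute-one σ) (λ eq′ → permute-zero≢permute-one ρ (trans (sym eq) eq′))

vote-ballot : (σ : Sym 2) → σ ≈ vote (ballot σ)
vote-ballot σ = sym₂-determined σ (vote (ballot σ)) (head (σ ⟨$⟩ʳ zero))
  where
  head : (a : Fin 2) → a ≡ vote (isZero a) ⟨$⟩ʳ zero
  head zero       = refl
  head (suc zero) = refl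

profileOf-readProfile : ∀ {h} (p : Profile h 2) → p ≈P profileOf (readProfile p)
profileOf-readProfile p i j = trans (vote-ballot (p i) j)
  (cong (λ b → vote b ⟨$⟩ʳ j) (sym (lookup∘tabulate (λ i → ballot (p i)) i)))

spfag₂⊆bgrxId : ∀ h W → SPFAG h 2 W → BGRxId h 2 2 W
spfag₂⊆bgrxId h W (G , W≐AG) =
  InvGroup F , (F , λ _ → mk⇔ (λ s → s) (λ s → s)) ,
  ≐-trans W≐AG (≐-trans (anonGroup-cong G (inducedSPF F code) G≈induced)
                        (anonGroup-inducedSPF F code code-injective))
  where
  F : BoolFun h 2
  F x = fun G (profileOf x) ⟨$⟩ʳ zero
  code : Fin 2 → Sym 2
  code a = vote (isZero a)
  code-injective : ∀ a a′ → code a ≈ code a′ → a ≡ a′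
  code-injective zero       zero       _ = refl
  code-injective (suc zero) (suc zero) _ = refl
  code-injective zero       (suc zero) eq with () ← eq zero
  code-injective (suc zero) zero       eq with () ← eq zero
  G≈induced : ∀ p → fun G p ≈ fun (inducedSPF F code) p
  G≈induced p j = trans (SPF.cong G (profileOf-readProfile p) j)
                        (vote-ballot (fun G (profileOf (readProfile p))) j)

proposition45 : ((h n k : ℕ) → 2 ≤ h → 2 ≤ n → 2 ≤ k → k ≤ n ! →
                    ∀ W → BGRxId h k n W → SPFAG h n W)
                × ((h : ℕ) → 2 ≤ h → ∀ W → (BGRxId h 2 2 W → SPFAG h 2 W) × (SPFAG h 2 W → BGRxId h 2 2 W))
                × (∀ hW → (BGR2xId-union hW → SPFAG2-union hW) × (SPFAG2-union hW → BGR2xId-union hW))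
proposition45 = inclusion , equality₂ , λ (h , W) →
    (λ (2≤h , B) → 2≤h , proj₁ (equality₂ h 2≤h W) B)
  , (λ (2≤h , S) → 2≤h , proj₂ (equality₂ h 2≤h W) S)
  where
  inclusion : (h n k : ℕ) → 2 ≤ h → 2 ≤ n → 2 ≤ k → k ≤ n ! → ∀ W → BGRxId h k n W → SPFAG h n W
  inclusion h n k _ 2≤n _ = bgrxId⊆spfag h n k 2≤n
  equality₂ : (h : ℕ) → 2 ≤ h → ∀ W → (BGRxId h 2 2 W → SPFAG h 2 W) × (SPFAG h 2 W → BGRxId h 2 2 W)
  equality₂ h _ W = bgrxId⊆spfag h 2 2 (s≤s (s≤s z≤n)) (s≤s (s≤s z≤n)) W , spfag₂⊆bgrxId h W
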